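{- For integers $m,n$ with $n\ge m\ge 1$ and $n\ge 2$, $R_{\pi}(mK_2,nK_2)=2n+m-1$.
   Context: All graphs are finite and simple. For graphs $F,G,H$, write $F\rightarrow(G,H)$ if every red-blue coloring of the edges of $F$ contains a red copy of $G$ or a blue copy of $H$. The Ramsey number $R(G,H)$ is the smallest $r$ with $K_r\rightarrow(G,H)$. $K_r\setminus P_k$ denotes $K_r$ with the edges of a path on $k$ vertices ($k\le r$) deleted. The path-critical Ramsey number is $R_{\pi}(G,H)=\max\{k: K_r\setminus P_k\rightarrow(G,H)\}$ where $r=R(G,H)$. $mK_2$ denotes a matching of $m$ vertex-disjoint edges. -}

module Defs where

open import Data.Nat using (ℕ; zero; suc; _+_; _*_; _∸_; _≤_; _<_; _/_)
open import Data.Fin using (Fin; toℕ)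
open import Data.Product using (Σ; _×_; ∃)
open import Data.Sum using (_⊎_)
open import Relation.Nullary using (¬_)
open import Relation.Binary.PropositionalEquality using (_≡_; _≢_)
open import Function.Definitions using (Injective)

-- A (finite) graph: vertex set Fin V, adjacency relation Adj.
-- All concrete graphs used below are simple (Adj symmetric and irreflexive).
record Graph : Set₁ where
  field
    V   : ℕ
    Adj : Fin V → Fin V → Set
open Graph public

data Colour : Set where
  red blue : Colour

-- A red-blue colouring of the edges of F: a symmetric colour assignment
-- to pairs of vertices (only its values on edges of F matter).
record Colouring (F : Graph) : Set where
  field
    col : Fin (V F) → Fin (V F) → Colour
    col-sym : ∀ i j → col i j ≡ col j i
open Colouring public

MonoCopy : (F : Graph) → Colouring F → Colour → Graph → Set
MonoCopy F c κ G =
  Σ (Fin (V G) → Fin (V F)) λ f →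
    Injective _≡_ _≡_ f ×
    (∀ u v → Adj G u v → Adj F (f u) (f v) × col c (f u) (f v) ≡ κ)

Arrows : Graph → Graph → Graph → Set
Arrows F G H = (c : Colouring F) → MonoCopy F c red G ⊎ MonoCopy F c blue H

K : ℕ → Graph
K r = record { V = r ; Adj = λ i j → i ≢ j }

PathEdge : ∀ {r} → ℕ → Fin r → Fin r → Set
PathEdge k i j =
  (toℕ j ≡ suc (toℕ i) × toℕ j < k) ⊎ (toℕ i ≡ suc (toℕ j) × toℕ i < k)

KminusP : ℕ → ℕ → Graph
KminusP r k = record { V = r ; Adj = λ i j → i ≢ j × ¬ PathEdge k i j }

-- m K_2 : vertices 0..2m-1, edges {2t, 2t+1}
matching : ℕ → Graph
matching m = record { V = m + m ; Adj = λ i j → i ≢ j × toℕ i / 2 ≡ toℕ j / 2 }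

IsRamseyNumber : Graph → Graph → ℕ → Set
IsRamseyNumber G H r = Arrows (K r) G H × (∀ s → s < r → ¬ Arrows (K s) G H)

IsPathCriticalRamseyNumber : Graph → Graph → ℕ → Set
IsPathCriticalRamseyNumber G H k =
  ∃ λ r → IsRamseyNumber G H r × k ≤ r × Arrows (KminusP r k) G H ×
    (∀ k′ → k′ ≤ r → Arrows (KminusP r k′) G H → k′ ≤ k)

module Submission where

-- With R = 2n + m − 1, the definition of R_π caps k at R, so the claim is that R(mK₂, nK₂) = R
-- (Cockayne–Lorimer) and that K_R minus a Hamiltonian path still arrows (mK₂, nK₂).
--
-- Lower bound: on s < R vertices colour red exactly the edges meeting the first m − 1 vertices.
-- A red mK₂ would need m disjoint edges through m − 1 vertices, a blue nK₂ would need 2n vertices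
-- outside them.
--
-- Upper bound, by induction on m: in K_N ∖ P_N with N = 2n + m − 1 the columns {t, n + t}, t < n,
-- are n disjoint edges. If they all have one colour we are done (m ≤ n); otherwise a blue and a red
-- column are joined by an edge, which yields a vertex x with a red edge xy and a blue edge xz.
-- Relabelling the other N − 3 vertices in increasing order keeps non-consecutive vertices
-- non-consecutive, so they carry a colouring of a supergraph of K_{N−3} ∖ P_{N−3}; induction gives
-- a red (m − 1)K₂, completed by xy, or a blue (n − 1)K₂, completed by xz. This needs n − 1 ≥ 2,
-- which leaves m = n = 2 as a base case: K₅ ∖ P₅ contains a 5-cycle, and in a 2-coloured 5-cycle
-- two disjoint edges share a colour.

open import Defs
open import Data.Bool.Base using (Bool; true; false; T; _∨_; if_then_else_)
open import Data.Bool.Properties using (∨-comm; T-∨)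
open import Data.Fin using (#_)
open import Data.Fin.Base using (Fin; zero; suc; toℕ; fromℕ<; inject≤; punchIn; punchOut; _<_)
open import Data.Fin.Properties
  using (_≟_; toℕ-injective; toℕ-fromℕ<; toℕ<n; inject≤-injective; punchIn-injective; punchInᵢ≢i;
         punchIn-cancel-≤; punchIn-punchOut; all?; ¬∀⟶∃¬; injective⇒≤)
open import Data.Nat.Base as ℕ using (ℕ; zero; suc; _+_; _*_; _∸_; _≤_; z≤n; s≤s; _/_; _<ᵇ_; ⌊_/2⌋; parity)
open import Data.Nat.DivMod using (m/n≡1+[m∸n]/n)
open import Data.Nat.Properties
  using (+-suc; +-comm; +-identityʳ; +-cancelˡ-≡; +-mono-≤; +-monoʳ-<; m≤m+n; n<1+n; n≤1+n;
         ≤-refl; ≤-reflexive; ≤-trans; ≤-total; ≤-pred; <-trans; <-irrefl; <-asym; <-cmp; <-≤-trans;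
         ≤-<-trans; <⇒≤; <⇒≢; >⇒≢; <⇒≱; ≰⇒>; ≮⇒≥; 1+n≰n; m≤n⇒m<n∨m≡n; ⌊n/2⌋+⌈n/2⌉≡n; ⌊n/2⌋≤⌈n/2⌉;
         ∸-monoˡ-<; ∸-cancelʳ-≡; m<n+o⇒m∸n<o; <ᵇ⇒<; <⇒<ᵇ)
open import Data.Parity.Base using (Parity; 0ℙ; 1ℙ; _⁻¹)
open import Data.Parity.Properties using (p≢p⁻¹)
open import Data.Product.Base using (Σ; ∃; _×_; _,_; proj₁; proj₂; map₁; map₂)
open import Data.Product.Properties using (,-injective; ,-injectiveˡ; ,-injectiveʳ)
open import Data.Sum.Base using (_⊎_; inj₁; inj₂; swap)
import Data.Sum.Base as Sum
open import Function.Base using (_∘_)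
open import Function.Bundles using (_⇔_; mk⇔; Equivalence)
open import Function.Definitions using (Injective)
open import Relation.Binary.Definitions using (Symmetric; tri<; tri≈; tri>)
open import Relation.Binary.PropositionalEquality
open import Relation.Nullary using (¬_; Dec; contradiction; yes; no)
open import Relation.Nullary.Decidable using (False; toWitnessFalse)

unhalve : Parity → ℕ → ℕ
unhalve 0ℙ t = t + t
unhalve 1ℙ t = suc (t + t)

unhalve-suc : ∀ p t → unhalve p (suc t) ≡ suc (suc (unhalve p t))
unhalve-suc 0ℙ t = cong suc (+-suc t t)
unhalve-suc 1ℙ t = cong (2 +_) (+-suc t t)

⌊unhalve/2⌋ : ∀ p t → ⌊ unhalve p t /2⌋ ≡ t
⌊unhalve/2⌋ 0ℙ zero = refl
⌊unhalve/2⌋ 1ℙ zero = refl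
⌊unhalve/2⌋ p (suc t) rewrite unhalve-suc p t = cong suc (⌊unhalve/2⌋ p t)

parity-unhalve : ∀ p t → parity (unhalve p t) ≡ p
parity-unhalve 0ℙ zero = refl
parity-unhalve 1ℙ zero = refl
parity-unhalve p (suc t) rewrite unhalve-suc p t = parity-unhalve p t

unhalve-parity-⌊/2⌋ : ∀ n → unhalve (parity n) ⌊ n /2⌋ ≡ n
unhalve-parity-⌊/2⌋ 0 = refl
unhalve-parity-⌊/2⌋ 1 = refl
unhalve-parity-⌊/2⌋ (suc (suc n)) =
  trans (unhalve-suc (parity n) ⌊ n /2⌋) (cong (2 +_) (unhalve-parity-⌊/2⌋ n))

unhalve-< : ∀ p {t s} → t ℕ.< s → unhalve p t ℕ.< s + s
unhalve-< p {t} {s} t<s = ≤-trans (bound p) (subst (ℕ._≤ s + s) (+-suc (suc t) t) (+-mono-≤ t<s t<s))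
  where
  bound : ∀ p → unhalve p t ℕ.< suc (suc (t + t))
  bound 0ℙ = <-trans (n<1+n (t + t)) (n<1+n (suc (t + t)))
  bound 1ℙ = n<1+n (suc (t + t))

⌊n/2⌋<s : ∀ {n s} → n ℕ.< s + s → ⌊ n /2⌋ ℕ.< s
⌊n/2⌋<s {n} {s} n<s+s = ≰⇒> λ s≤⌊n/2⌋ →
  <⇒≱ n<s+s (subst (_ ≤_) (⌊n/2⌋+⌈n/2⌉≡n n) (+-mono-≤ s≤⌊n/2⌋ (≤-trans s≤⌊n/2⌋ (⌊n/2⌋≤⌈n/2⌉ n))))

⌊n/2⌋≡n/2 : ∀ n → ⌊ n /2⌋ ≡ n / 2
⌊n/2⌋≡n/2 0 = refl
⌊n/2⌋≡n/2 1 = refl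
⌊n/2⌋≡n/2 (suc (suc n)) = trans (cong suc (⌊n/2⌋≡n/2 n)) (sym (m/n≡1+[m∸n]/n {suc (suc n)} (s≤s (s≤s z≤n))))

≢⇒≡⁻¹ : ∀ {p q : Parity} → p ≢ q → q ≡ p ⁻¹
≢⇒≡⁻¹ {0ℙ} {0ℙ} p≢q = contradiction refl p≢q
≢⇒≡⁻¹ {0ℙ} {1ℙ} _ = refl
≢⇒≡⁻¹ {1ℙ} {0ℙ} _ = refl
≢⇒≡⁻¹ {1ℙ} {1ℙ} p≢q = contradiction refl p≢q

mate : ∀ {s} → Parity × Fin s → Parity × Fin s
mate (p , t) = p ⁻¹ , t

module _ {s : ℕ} where

  pairOf : Fin (s + s) → Fin s
  pairOf u = fromℕ< (⌊n/2⌋<s (toℕ<n u))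

  toℕ-pairOf : ∀ u → toℕ (pairOf u) ≡ ⌊ toℕ u /2⌋
  toℕ-pairOf u = toℕ-fromℕ< _

  pairOf-≡⇔ : ∀ u v → pairOf u ≡ pairOf v ⇔ toℕ u / 2 ≡ toℕ v / 2
  pairOf-≡⇔ u v = mk⇔
    (λ eq → trans (sym (toℕ-pairOf′ u)) (trans (cong toℕ eq) (toℕ-pairOf′ v)))
    (λ eq → toℕ-injective (trans (toℕ-pairOf′ u) (trans eq (sym (toℕ-pairOf′ v)))))
    where
    toℕ-pairOf′ : ∀ u → toℕ (pairOf u) ≡ toℕ u / 2
    toℕ-pairOf′ u = trans (toℕ-pairOf u) (⌊n/2⌋≡n/2 (toℕ u))

  split : Fin (s + s) → Parity × Fin s
  split u = parity (toℕ u) , pairOf u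

  vertex : Parity × Fin s → Fin (s + s)
  vertex (p , t) = fromℕ< (unhalve-< p (toℕ<n t))

  toℕ-vertex : ∀ p t → toℕ (vertex (p , t)) ≡ unhalve p (toℕ t)
  toℕ-vertex p t = toℕ-fromℕ< _

  split-vertex : ∀ e → split (vertex e) ≡ e
  split-vertex (p , t) = cong₂ _,_
    (trans (cong parity (toℕ-vertex p t)) (parity-unhalve p (toℕ t)))
    (toℕ-injective (trans (toℕ-pairOf (vertex (p , t)))
      (trans (cong ⌊_/2⌋ (toℕ-vertex p t)) (⌊unhalve/2⌋ p (toℕ t)))))

  split-injective : Injective _≡_ _≡_ split
  split-injective {u} {v} eq = toℕ-injective (begin
    toℕ u                                     ≡⟨ unhalve-parity-⌊/2⌋ (toℕ u) ⟨
    unhalve (parity (toℕ u)) ⌊ toℕ u /2⌋      ≡⟨ cong₂ unhalve (,-injectiveˡ eq) ⌊u/2⌋≡⌊v/2⌋ ⟩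
    unhalve (parity (toℕ v)) ⌊ toℕ v /2⌋      ≡⟨ unhalve-parity-⌊/2⌋ (toℕ v) ⟩
    toℕ v                                     ∎)
    where
    open ≡-Reasoning
    ⌊u/2⌋≡⌊v/2⌋ : ⌊ toℕ u /2⌋ ≡ ⌊ toℕ v /2⌋
    ⌊u/2⌋≡⌊v/2⌋ = trans (sym (toℕ-pairOf u)) (trans (cong toℕ (,-injectiveʳ eq)) (toℕ-pairOf v))

  vertex-injective : Injective _≡_ _≡_ vertex
  vertex-injective {e} {e′} eq = trans (sym (split-vertex e)) (trans (cong split eq) (split-vertex e′))

  matching-adj⇒ : ∀ {u v} → Adj (matching s) u v → split v ≡ mate (split u)
  matching-adj⇒ {u} {v} (u≢v , u/2≡v/2) = cong₂ _,_
    (≢⇒≡⁻¹ λ same-parity → u≢v (split-injective (cong₂ _,_ same-parity (sym pairOf-v≡pairOf-u))))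
    pairOf-v≡pairOf-u
    where
    pairOf-v≡pairOf-u : pairOf v ≡ pairOf u
    pairOf-v≡pairOf-u = Equivalence.from (pairOf-≡⇔ v u) (sym u/2≡v/2)

  matching-adj⇐ : ∀ {u v} → split v ≡ mate (split u) → Adj (matching s) u v
  matching-adj⇐ {u} {v} eq =
    (λ { refl → p≢p⁻¹ _ (,-injectiveˡ eq) }) ,
    Equivalence.to (pairOf-≡⇔ u v) (sym (,-injectiveʳ eq))

  matching-adj-vertex : ∀ e → Adj (matching s) (vertex e) (vertex (mate e))
  matching-adj-vertex e = matching-adj⇐ (trans (split-vertex (mate e)) (cong mate (sym (split-vertex e))))

  matching-adj-mate : ∀ u → Adj (matching s) u (vertex (mate (split u)))
  matching-adj-mate u = matching-adj⇐ (split-vertex _)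

opposite : Colour → Colour
opposite red = blue
opposite blue = red

≢⇒≡opposite : ∀ {κ′ κ} → κ′ ≢ κ → κ′ ≡ opposite κ
≢⇒≡opposite {red} {red} κ′≢κ = contradiction refl κ′≢κ
≢⇒≡opposite {red} {blue} _ = refl
≢⇒≡opposite {blue} {red} _ = refl
≢⇒≡opposite {blue} {blue} κ′≢κ = contradiction refl κ′≢κ

≢-≢⇒≡ : ∀ {κ κ′ κ″ : Colour} → κ ≢ κ′ → κ′ ≢ κ″ → κ ≡ κ″
≢-≢⇒≡ κ≢κ′ κ′≢κ″ = trans (≢⇒≡opposite κ≢κ′) (sym (≢⇒≡opposite (κ′≢κ″ ∘ sym)))

_≟ᶜ_ : (κ κ′ : Colour) → Dec (κ ≡ κ′)
red ≟ᶜ red = yes refl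
red ≟ᶜ blue = no λ ()
blue ≟ᶜ red = no λ ()
blue ≟ᶜ blue = yes refl

module _ {G : Graph} (c : Colouring G) where

  Edge : Colour → Fin (V G) → Fin (V G) → Set
  Edge κ x y = Adj G x y × col c x y ≡ κ

  edge-sym : Symmetric (Adj G) → ∀ {κ x y} → Edge κ x y → Edge κ y x
  edge-sym adj-sym {x = x} {y} (xy , col≡κ) = adj-sym xy , trans (col-sym c y x) col≡κ

record Matching {G : Graph} (c : Colouring G) (κ : Colour) (s : ℕ) : Set where
  field
    end : Parity × Fin s → Fin (V G)
    end-injective : Injective _≡_ _≡_ end
    edge : ∀ t → Edge c κ (end (0ℙ , t)) (end (1ℙ , t))

pullback : ∀ {G H : Graph} → (Fin (V G) → Fin (V H)) → Colouring H → Colouring G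
pullback h c = record { col = λ i j → col c (h i) (h j) ; col-sym = λ i j → col-sym c (h i) (h j) }

module _ {G : Graph} {c : Colouring G} {κ : Colour} where

  emptyMatching : Matching c κ 0
  emptyMatching = record { end = λ { (_ , ()) } ; end-injective = λ { {_ , ()} } ; edge = λ () }

  extendMatching : ∀ {s x y} (M : Matching c κ s) → let open Matching M in
                   Edge c κ x y → x ≢ y → (∀ e → end e ≢ x) → (∀ e → end e ≢ y) → Matching c κ (suc s)
  extendMatching {s} {x} {y} M xy x≢y x∉M y∉M =
    record { end = end′ ; end-injective = end′-injective ; edge = edge′ }
    where
    open Matching M
    end′ : Parity × Fin (suc s) → Fin (V G)
    end′ (p , suc t) = end (p , t)
    end′ (0ℙ , zero) = x
    end′ (1ℙ , zero) = y
    end′-injective : Injective _≡_ _≡_ end′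
    end′-injective {0ℙ , zero} {0ℙ , zero} _ = refl
    end′-injective {0ℙ , zero} {1ℙ , zero} x≡y = contradiction x≡y x≢y
    end′-injective {1ℙ , zero} {0ℙ , zero} y≡x = contradiction (sym y≡x) x≢y
    end′-injective {1ℙ , zero} {1ℙ , zero} _ = refl
    end′-injective {0ℙ , zero} {_ , suc _} eq = contradiction (sym eq) (x∉M _)
    end′-injective {1ℙ , zero} {_ , suc _} eq = contradiction (sym eq) (y∉M _)
    end′-injective {_ , suc _} {0ℙ , zero} eq = contradiction eq (x∉M _)
    end′-injective {_ , suc _} {1ℙ , zero} eq = contradiction eq (y∉M _)
    end′-injective {_ , suc _} {_ , suc _} eq = cong (map₂ suc) (end-injective eq)
    edge′ : ∀ t → Edge c κ (end′ (0ℙ , t)) (end′ (1ℙ , t))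
    edge′ zero = xy
    edge′ (suc t) = edge t

  shrinkMatching : ∀ {s s′} → s ≤ s′ → Matching c κ s′ → Matching c κ s
  shrinkMatching s≤s′ M = record
    { end = end ∘ map₂ inject
    ; end-injective = λ eq → let p≡q , t≡u = ,-injective (end-injective eq) in
                             cong₂ _,_ p≡q (inject≤-injective s≤s′ s≤s′ _ _ t≡u)
    ; edge = edge ∘ inject
    }
    where
    open Matching M
    inject : Fin _ → Fin _
    inject t = inject≤ t s≤s′

  matching⇒monoCopy : Symmetric (Adj G) → ∀ {s} → Matching c κ s → MonoCopy G c κ (matching s)
  matching⇒monoCopy adj-sym {s} M = end ∘ split , split-injective ∘ end-injective , copy-edge
    where
    open Matching M
    edge-mate : ∀ e → Edge c κ (end e) (end (mate e))
    edge-mate (0ℙ , t) = edge t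
    edge-mate (1ℙ , t) = edge-sym c adj-sym (edge t)
    copy-edge : ∀ u v → Adj (matching s) u v → Edge c κ (end (split u)) (end (split v))
    copy-edge u v adj = subst (Edge c κ (end (split u)) ∘ end) (sym (matching-adj⇒ adj)) (edge-mate (split u))

module _ {G H : Graph} (h : Fin (V G) → Fin (V H)) (h-injective : Injective _≡_ _≡_ h)
         (h-adj : ∀ {i j} → Adj G i j → Adj H (h i) (h j)) {c : Colouring H} {κ : Colour} where

  pushMatching : ∀ {s} → Matching (pullback {G} h c) κ s → Matching c κ s
  pushMatching M = record
    { end = h ∘ end ; end-injective = end-injective ∘ h-injective ; edge = λ t → map₁ h-adj (edge t) }
    where open Matching M

byColour : ∀ {G : Graph} {c : Colouring G} {κ s} → Matching c κ s → Matching c red s ⊎ Matching c blue s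
byColour {κ = red} M = inj₁ M
byColour {κ = blue} M = inj₂ M

arrows-⊆ : ∀ {r} {A A′ : Fin r → Fin r → Set} {G H : Graph} → (∀ {i j} → A i j → A′ i j) →
           Arrows (record { V = r ; Adj = A }) G H → Arrows (record { V = r ; Adj = A′ }) G H
arrows-⊆ {r} {A} {A′} A⊆A′ arrows c = Sum.map widen widen (arrows c′)
  where
  c′ : Colouring (record { V = r ; Adj = A })
  c′ = record { col = col c ; col-sym = col-sym c }
  widen : ∀ {κ G} → MonoCopy _ c′ κ G → MonoCopy _ c κ G
  widen (f , f-injective , f-edge) = f , f-injective , λ u v uv → map₁ A⊆A′ (f-edge u v uv)

module _ {r k : ℕ} where

  KminusP-sym : Symmetric (Adj (KminusP r k))
  KminusP-sym (i≢j , ¬path) = i≢j ∘ sym , ¬path ∘ swap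

  KminusP-far : ∀ {i j} → 2 + toℕ i ≤ toℕ j → Adj (KminusP r k) i j
  KminusP-far {i} {j} 2+i≤j =
    (λ i≡j → <⇒≢ i<j (cong toℕ i≡j)) ,
    λ { (inj₁ (j≡1+i , _)) → <⇒≢ 2+i≤j (sym j≡1+i)
      ; (inj₂ (i≡1+j , _)) → <-asym i<j (≤-reflexive (sym i≡1+j)) }
    where
    i<j : toℕ i ℕ.< toℕ j
    i<j = <-trans (n<1+n (toℕ i)) 2+i≤j

Increasing : ∀ {m n} → (Fin m → Fin n) → Set
Increasing f = ∀ {i j} → i < j → f i < f j

module _ {m n : ℕ} {f : Fin m → Fin n} (f-increasing : Increasing f) where

  increasing-injective : Injective _≡_ _≡_ f
  increasing-injective {i} {j} fi≡fj with <-cmp (toℕ i) (toℕ j)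
  ... | tri< i<j _ _ = contradiction (cong toℕ fi≡fj) (<⇒≢ (f-increasing i<j))
  ... | tri≈ _ i≡j _ = toℕ-injective i≡j
  ... | tri> _ _ j<i = contradiction (cong toℕ fi≡fj) (>⇒≢ (f-increasing j<i))

  increasing-mono-≤ : ∀ {i j} → toℕ i ≤ toℕ j → toℕ (f i) ≤ toℕ (f j)
  increasing-mono-≤ i≤j with m≤n⇒m<n∨m≡n i≤j
  ... | inj₁ i<j = <⇒≤ (f-increasing i<j)
  ... | inj₂ i≡j = ≤-reflexive (cong (toℕ ∘ f) (toℕ-injective i≡j))

  increasing-reflects-suc : ∀ {i j} → toℕ (f j) ≡ suc (toℕ (f i)) → toℕ j ≡ suc (toℕ i)
  increasing-reflects-suc {i} {j} fj≡1+fi with <-cmp (toℕ j) (suc (toℕ i))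
  ... | tri< j<1+i _ _ = contradiction (increasing-mono-≤ (≤-pred j<1+i)) (<⇒≱ (≤-reflexive (sym fj≡1+fi)))
  ... | tri≈ _ j≡1+i _ = j≡1+i
  ... | tri> _ _ 1+i<j = contradiction (≤-<-trans (f-increasing i<k) (f-increasing k<j)) (<-irrefl (sym fj≡1+fi))
    where
    k : Fin m
    k = fromℕ< (<-trans 1+i<j (toℕ<n j))
    i<k : i < k
    i<k = ≤-reflexive (sym (toℕ-fromℕ< _))
    k<j : k < j
    k<j = subst (ℕ._< toℕ j) (sym (toℕ-fromℕ< _)) 1+i<j

  increasing-KminusP : ∀ {i j} → Adj (KminusP m m) i j → Adj (KminusP n n) (f i) (f j)
  increasing-KminusP {i} {j} (i≢j , ¬path) = i≢j ∘ increasing-injective ,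
    λ { (inj₁ (fj≡1+fi , _)) → ¬path (inj₁ (increasing-reflects-suc fj≡1+fi , toℕ<n j))
      ; (inj₂ (fi≡1+fj , _)) → ¬path (inj₂ (increasing-reflects-suc fi≡1+fj , toℕ<n i)) }

punchIn-increasing : ∀ {M} (x : Fin (suc M)) → Increasing (punchIn x)
punchIn-increasing x {j} {k} j<k = ≰⇒> λ ↑k≤↑j → <⇒≱ j<k (punchIn-cancel-≤ x k j ↑k≤↑j)

record Deletion {M : ℕ} (x y z : Fin (3 + M)) : Set where
  field
    embed : Fin M → Fin (3 + M)
    embed-increasing : Increasing embed
    embed-avoids : ∀ w → embed w ≢ x × embed w ≢ y × embed w ≢ z

delete : ∀ {M} {x y z : Fin (3 + M)} → x ≢ y → x ≢ z → y ≢ z → Deletion x y z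
delete {M} {x} {y} {z} x≢y x≢z y≢z = record
  { embed = punchIn x ∘ punchIn y′ ∘ punchIn z″
  ; embed-increasing = punchIn-increasing x ∘ punchIn-increasing y′ ∘ punchIn-increasing z″
  ; embed-avoids = λ w →
      punchInᵢ≢i x _ ,
      (λ eq → punchInᵢ≢i y′ _ (punchIn-injective x _ _ (trans eq (sym ↑y′≡y)))) ,
      (λ eq → punchInᵢ≢i z″ _ (punchIn-injective y′ _ _ (punchIn-injective x _ _ (trans eq (sym ↑↑z″≡z)))))
  }
  where
  y′ z′ : Fin (2 + M)
  y′ = punchOut x≢y
  z′ = punchOut x≢z
  ↑y′≡y : punchIn x y′ ≡ y
  ↑y′≡y = punchIn-punchOut x≢y
  y′≢z′ : y′ ≢ z′
  y′≢z′ y′≡z′ = y≢z (trans (sym ↑y′≡y) (trans (cong (punchIn x) y′≡z′) (punchIn-punchOut x≢z)))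
  z″ : Fin (1 + M)
  z″ = punchOut y′≢z′
  ↑↑z″≡z : punchIn x (punchIn y′ z″) ≡ z
  ↑↑z″≡z = trans (cong (punchIn x) (punchIn-punchOut y′≢z′)) (punchIn-punchOut x≢z)

record MixedVertex {G : Graph} (c : Colouring G) : Set where
  field
    centre red-end blue-end : Fin (V G)
    red-edge : Edge c red centre red-end
    blue-edge : Edge c blue centre blue-end

mixedVertex : ∀ {G : Graph} {c : Colouring G} → Symmetric (Adj G) → ∀ {p q u v} →
              Edge c blue p q → Edge c red u v → Adj G p u → MixedVertex c
mixedVertex {c = c} adj-sym {p} {q} {u} {v} pq uv pu with col c p u in pu-colour
... | red = record { centre = p ; red-end = u ; blue-end = q ; red-edge = pu , pu-colour ; blue-edge = pq }
... | blue = record { centre = u ; red-end = v ; blue-end = p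
                   ; red-edge = uv ; blue-edge = edge-sym c adj-sym (pu , pu-colour) }

module Columns {N n : ℕ} (n+n≤N : n + n ≤ N) (2≤n : 2 ≤ n) (c : Colouring (KminusP N N)) where

  offset : Parity → ℕ
  offset 0ℙ = 0
  offset 1ℙ = n

  column : Parity × Fin n → Fin N
  column (p , t) = fromℕ< (<-≤-trans (+-monoʳ-< (offset p) (toℕ<n t)) (offset+n≤N p))
    where
    offset+n≤N : ∀ p → offset p + n ≤ N
    offset+n≤N 0ℙ = ≤-trans (m≤m+n n n) n+n≤N
    offset+n≤N 1ℙ = n+n≤N

  toℕ-column : ∀ p t → toℕ (column (p , t)) ≡ offset p + toℕ t
  toℕ-column p t = toℕ-fromℕ< _

  column-injective : Injective _≡_ _≡_ column
  column-injective {p , t} {q , u} eq =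
    lemma p q (trans (sym (toℕ-column p t)) (trans (cong toℕ eq) (toℕ-column q u)))
    where
    lemma : ∀ p q → offset p + toℕ t ≡ offset q + toℕ u → (p , t) ≡ (q , u)
    lemma 0ℙ 0ℙ t≡u = cong (0ℙ ,_) (toℕ-injective t≡u)
    lemma 1ℙ 1ℙ n+t≡n+u = cong (1ℙ ,_) (toℕ-injective (+-cancelˡ-≡ n _ _ n+t≡n+u))
    lemma 0ℙ 1ℙ t≡n+u = contradiction (≤-trans (m≤m+n n (toℕ u)) (≤-reflexive (sym t≡n+u))) (<⇒≱ (toℕ<n t))
    lemma 1ℙ 0ℙ n+t≡u = contradiction (≤-trans (m≤m+n n (toℕ t)) (≤-reflexive n+t≡u)) (<⇒≱ (toℕ<n u))

  column-adj : ∀ {t u} → toℕ t ≤ toℕ u → Adj (KminusP N N) (column (0ℙ , t)) (column (1ℙ , u))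
  column-adj {t} {u} t≤u = KminusP-far
    (subst₂ _≤_ (cong (2 +_) (sym (toℕ-column 0ℙ t))) (sym (toℕ-column 1ℙ u)) (+-mono-≤ 2≤n t≤u))

  ColumnEdge : Colour → Fin n → Set
  ColumnEdge κ t = Edge c κ (column (0ℙ , t)) (column (1ℙ , t))

  column-colour? : ∀ κ t → Dec (col c (column (0ℙ , t)) (column (1ℙ , t)) ≡ κ)
  column-colour? κ t = col c (column (0ℙ , t)) (column (1ℙ , t)) ≟ᶜ κ

  columns : ∀ κ → Matching c κ n ⊎ ∃ (ColumnEdge (opposite κ))
  columns κ with all? (column-colour? κ)
  ... | yes all-κ = inj₁ record
    { end = column ; end-injective = column-injective ; edge = λ t → column-adj ≤-refl , all-κ t }
  ... | no ¬all-κ = let t , colour≢κ = ¬∀⟶∃¬ n _ (column-colour? κ) ¬all-κ in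
                    inj₂ (t , column-adj ≤-refl , ≢⇒≡opposite colour≢κ)

  monochromatic-or-mixed : Matching c red n ⊎ Matching c blue n ⊎ MixedVertex c
  monochromatic-or-mixed with columns red | columns blue
  ... | inj₁ reds | _ = inj₁ reds
  ... | inj₂ _ | inj₁ blues = inj₂ (inj₁ blues)
  ... | inj₂ (t , blue-t) | inj₂ (u , red-u) = inj₂ (inj₂ (mixed (≤-total (toℕ t) (toℕ u))))
    where
    mixed : toℕ t ≤ toℕ u ⊎ toℕ u ≤ toℕ t → MixedVertex c
    mixed (inj₁ t≤u) = mixedVertex KminusP-sym blue-t (edge-sym c KminusP-sym red-u) (column-adj t≤u)
    mixed (inj₂ u≤t) =
      mixedVertex KminusP-sym (edge-sym c KminusP-sym blue-t) red-u (KminusP-sym (column-adj u≤t))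

two-colouring-C₅ : ∀ (k₀ k₁ k₂ k₃ k₄ : Colour) → k₀ ≡ k₂ ⊎ k₁ ≡ k₃ ⊎ k₂ ≡ k₄ ⊎ k₃ ≡ k₀ ⊎ k₄ ≡ k₁
two-colouring-C₅ k₀ k₁ k₂ k₃ k₄ with k₀ ≟ᶜ k₂ | k₂ ≟ᶜ k₄ | k₄ ≟ᶜ k₁ | k₁ ≟ᶜ k₃
... | yes k₀≡k₂ | _ | _ | _ = inj₁ k₀≡k₂
... | no _ | yes k₂≡k₄ | _ | _ = inj₂ (inj₂ (inj₁ k₂≡k₄))
... | no _ | no _ | yes k₄≡k₁ | _ = inj₂ (inj₂ (inj₂ (inj₂ k₄≡k₁)))
... | no _ | no _ | no _ | yes k₁≡k₃ = inj₂ (inj₁ k₁≡k₃)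
... | no k₀≢k₂ | no k₂≢k₄ | no k₄≢k₁ | no k₁≢k₃ =
  inj₂ (inj₂ (inj₂ (inj₁ (sym (trans (≢-≢⇒≡ k₀≢k₂ k₂≢k₄) (≢-≢⇒≡ k₄≢k₁ k₁≢k₃))))))

module _ (c : Colouring (KminusP 5 5)) where

  twoEdges : ∀ {κ} (a b a′ b′ : Fin 5) →
             {False (a′ ≟ a)} → {False (b′ ≟ a)} → {False (a′ ≟ b)} → {False (b′ ≟ b)} →
             Edge c κ a b → Edge c κ a′ b′ → Matching c κ 2
  twoEdges a b a′ b′ {a′≢a} {b′≢a} {a′≢b} {b′≢b} ab a′b′ =
    extendMatching a′b′-matching ab (proj₁ (proj₁ ab))
    (λ { (0ℙ , zero) → toWitnessFalse a′≢a ; (1ℙ , zero) → toWitnessFalse b′≢a })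
    (λ { (0ℙ , zero) → toWitnessFalse a′≢b ; (1ℙ , zero) → toWitnessFalse b′≢b })
    where
    a′b′-matching : Matching c _ 1
    a′b′-matching = extendMatching emptyMatching a′b′ (proj₁ (proj₁ a′b′)) (λ { (_ , ()) }) (λ { (_ , ()) })

  -- 0-2-4-1-3-0 is a 5-cycle in K₅ ∖ P₅; its edges eᵢ and eᵢ₊₂ are disjoint.
  e₀ : Adj (KminusP 5 5) (# 0) (# 2)
  e₀ = KminusP-far ≤-refl
  e₁ : Adj (KminusP 5 5) (# 2) (# 4)
  e₁ = KminusP-far ≤-refl
  e₂ : Adj (KminusP 5 5) (# 4) (# 1)
  e₂ = KminusP-sym (KminusP-far (n≤1+n 3))
  e₃ : Adj (KminusP 5 5) (# 1) (# 3)
  e₃ = KminusP-far ≤-refl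
  e₄ : Adj (KminusP 5 5) (# 3) (# 0)
  e₄ = KminusP-sym (KminusP-far (n≤1+n 2))

  pentagon : Matching c red 2 ⊎ Matching c blue 2
  pentagon with two-colouring-C₅ (col c (# 0) (# 2)) (col c (# 2) (# 4)) (col c (# 4) (# 1))
                                 (col c (# 1) (# 3)) (col c (# 3) (# 0))
  ... | inj₁ k₀≡k₂ = byColour (twoEdges (# 0) (# 2) (# 4) (# 1) (e₀ , refl) (e₂ , sym k₀≡k₂))
  ... | inj₂ (inj₁ k₁≡k₃) = byColour (twoEdges (# 2) (# 4) (# 1) (# 3) (e₁ , refl) (e₃ , sym k₁≡k₃))
  ... | inj₂ (inj₂ (inj₁ k₂≡k₄)) = byColour (twoEdges (# 4) (# 1) (# 3) (# 0) (e₂ , refl) (e₄ , sym k₂≡k₄))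
  ... | inj₂ (inj₂ (inj₂ (inj₁ k₃≡k₀))) = byColour (twoEdges (# 1) (# 3) (# 0) (# 2) (e₃ , refl) (e₀ , sym k₃≡k₀))
  ... | inj₂ (inj₂ (inj₂ (inj₂ k₄≡k₁))) = byColour (twoEdges (# 3) (# 0) (# 2) (# 4) (e₄ , refl) (e₁ , sym k₄≡k₁))

module _ {M : ℕ} {c : Colouring (KminusP (3 + M) (3 + M))} (mixed : MixedVertex c) where

  open MixedVertex mixed

  centre≢red-end : centre ≢ red-end
  centre≢red-end = proj₁ (proj₁ red-edge)

  centre≢blue-end : centre ≢ blue-end
  centre≢blue-end = proj₁ (proj₁ blue-edge)

  red-end≢blue-end : red-end ≢ blue-end
  red-end≢blue-end eq =
    contradiction (trans (sym (proj₂ red-edge)) (trans (cong (col c centre) eq) (proj₂ blue-edge))) λ ()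

  open Deletion (delete centre≢red-end centre≢blue-end red-end≢blue-end)

  extendBy : ∀ {κ s w} → Edge c κ centre w → centre ≢ w → (∀ v → embed v ≢ w) →
             Matching (pullback embed c) κ s → Matching c κ (suc s)
  extendBy e centre≢w w∉embed M =
    extendMatching
      (pushMatching embed (increasing-injective embed-increasing) (increasing-KminusP embed-increasing) M)
      e centre≢w (proj₁ ∘ embed-avoids ∘ Matching.end M) (w∉embed ∘ Matching.end M)

  grow : ∀ {m n} → ((c′ : Colouring (KminusP M M)) → Matching c′ red m ⊎ Matching c′ blue n) →
         Matching c red (suc m) ⊎ Matching c blue (suc n)
  grow matchings = Sum.map
    (extendBy red-edge centre≢red-end (proj₁ ∘ proj₂ ∘ embed-avoids))
    (extendBy blue-edge centre≢blue-end (proj₂ ∘ proj₂ ∘ embed-avoids))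
    (matchings (pullback embed c))

KminusP-matchings : ∀ m′ n {N} → N ≡ n + n + m′ → m′ ℕ.< n → 2 ≤ n → (c : Colouring (KminusP N N)) →
                    Matching c red (suc m′) ⊎ Matching c blue n
KminusP-matchings zero n refl _ 2≤n c with Columns.columns (m≤m+n (n + n) 0) 2≤n c blue
... | inj₁ blues = inj₂ blues
... | inj₂ (_ , red-edge) =
  inj₁ (extendMatching emptyMatching red-edge (proj₁ (proj₁ red-edge)) (λ { (_ , ()) }) (λ { (_ , ()) }))
KminusP-matchings (suc zero) 2 refl _ _ c = pentagon c
KminusP-matchings (suc _) 1 _ (s≤s ()) _ _
KminusP-matchings (suc (suc _)) 2 _ (s≤s (s≤s ())) _ _
KminusP-matchings (suc m″) (suc (suc (suc n″))) refl m′<n@(s≤s m″<n′) 2≤n c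
  with Columns.monochromatic-or-mixed (m≤m+n (n + n) (suc m″)) 2≤n c
  where
  n : ℕ
  n = suc (suc (suc n″))
... | inj₁ reds = inj₁ (shrinkMatching m′<n reds)
... | inj₂ (inj₁ blues) = inj₂ blues
... | inj₂ (inj₂ mixed) = grow mixed (KminusP-matchings m″ (suc (suc n″)) M≡ m″<n′ (s≤s (s≤s z≤n)))
  where
  M≡ : n″ + suc (suc (suc n″)) + suc m″ ≡ suc (suc n″) + suc (suc n″) + m″
  M≡ = trans (+-suc _ m″) (cong (λ k → suc (k + m″)) (+-suc n″ (suc (suc n″))))

injective-below⇒≤ : ∀ {k s b} {f : Fin k → Fin s} → Injective _≡_ _≡_ f → (∀ i → toℕ (f i) ℕ.< b) → k ≤ b
injective-below⇒≤ {f = f} f-injective f<b = injective⇒≤ {f = λ i → fromℕ< (f<b i)} λ eq →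
  f-injective (toℕ-injective (trans (sym (toℕ-fromℕ< (f<b _))) (trans (cong toℕ eq) (toℕ-fromℕ< (f<b _)))))

injective-above⇒≤ : ∀ {k s b} {f : Fin k → Fin s} → Injective _≡_ _≡_ f → (∀ i → b ≤ toℕ (f i)) → k ≤ s ∸ b
injective-above⇒≤ {k} {s} {b} {f} f-injective b≤f = injective⇒≤ {f = λ i → fromℕ< (f∸b<s∸b i)} λ eq →
  f-injective (toℕ-injective (∸-cancelʳ-≡ (b≤f _) (b≤f _)
    (trans (sym (toℕ-fromℕ< (f∸b<s∸b _))) (trans (cong toℕ eq) (toℕ-fromℕ< (f∸b<s∸b _))))))
  where
  f∸b<s∸b : ∀ i → toℕ (f i) ∸ b ℕ.< s ∸ b
  f∸b<s∸b i = ∸-monoˡ-< (toℕ<n (f i)) (b≤f i)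

coreColouring : ℕ → (s : ℕ) → Colouring (K s)
coreColouring m′ s = record
  { col = λ i j → if core i ∨ core j then red else blue
  ; col-sym = λ i j → cong (λ b → if b then red else blue) (∨-comm (core i) (core j))
  }
  where
  core : Fin s → Bool
  core i = toℕ i <ᵇ m′

module _ (m′ : ℕ) {s : ℕ} (i j : Fin s) where

  coreColouring-red : col (coreColouring m′ s) i j ≡ red → toℕ i ℕ.< m′ ⊎ toℕ j ℕ.< m′
  coreColouring-red eq = Sum.map (<ᵇ⇒< _ _) (<ᵇ⇒< _ _) (Equivalence.to T-∨ (if-red _ eq))
    where
    if-red : ∀ b → (if b then red else blue) ≡ red → T b
    if-red true _ = _

  coreColouring-blue : col (coreColouring m′ s) i j ≡ blue → m′ ≤ toℕ i
  coreColouring-blue eq = ≮⇒≥ λ i<m′ → if-blue _ eq (Equivalence.from T-∨ (inj₁ (<⇒<ᵇ i<m′)))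
    where
    if-blue : ∀ b → (if b then red else blue) ≡ blue → ¬ T b
    if-blue false _ ()

¬K-arrows-matchings : ∀ {s m′ n} → 1 ≤ n → s ℕ.< n + n + m′ → ¬ Arrows (K s) (matching (suc m′)) (matching n)
¬K-arrows-matchings {s} {m′} {n@(suc _)} _ s<N arrows with arrows (coreColouring m′ s)
... | inj₁ (f , f-injective , f-red) = 1+n≰n (injective-below⇒≤ g-injective g<m′)
  where
  coreEnd : ∀ t → Σ Parity λ p → toℕ (f (vertex {suc m′} (p , t))) ℕ.< m′
  coreEnd t with coreColouring-red m′ (f (vertex (0ℙ , t))) (f (vertex (1ℙ , t)))
                    (proj₂ (f-red _ _ (matching-adj-vertex (0ℙ , t))))
  ... | inj₁ f0<m′ = 0ℙ , f0<m′
  ... | inj₂ f1<m′ = 1ℙ , f1<m′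
  g : Fin (suc m′) → Fin s
  g t = f (vertex (proj₁ (coreEnd t) , t))
  g<m′ : ∀ t → toℕ (g t) ℕ.< m′
  g<m′ t = proj₂ (coreEnd t)
  g-injective : Injective _≡_ _≡_ g
  g-injective {t} {t′} eq =
    ,-injectiveʳ (vertex-injective {x = proj₁ (coreEnd t) , t} {proj₁ (coreEnd t′) , t′} (f-injective eq))
... | inj₂ (f , f-injective , f-blue) =
  <⇒≱ (m<n+o⇒m∸n<o s m′ (subst (s ℕ.<_) (+-comm (n + n) m′) s<N))
      (injective-above⇒≤ f-injective λ u →
        coreColouring-blue m′ (f u) (f (vertex {n} (mate (split u))))
          (proj₂ (f-blue _ _ (matching-adj-mate u))))

theorem5 : (m n : ℕ) → 1 ≤ m → m ≤ n → 2 ≤ n →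
    IsPathCriticalRamseyNumber (matching m) (matching n) (2 * n + m ∸ 1)
theorem5 (suc m′) n _ m≤n 2≤n =
  R , (arrows-⊆ proj₁ KminusP-arrows , below-R) , ≤-refl , KminusP-arrows , λ _ k′≤R _ → k′≤R
  where
  R : ℕ
  R = 2 * n + suc m′ ∸ 1
  R≡ : R ≡ n + n + m′
  R≡ = trans (cong (_∸ 1) (+-suc (2 * n) m′)) (cong (λ k → n + k + m′) (+-identityʳ n))
  KminusP-arrows : Arrows (KminusP R R) (matching (suc m′)) (matching n)
  KminusP-arrows c = Sum.map (matching⇒monoCopy KminusP-sym) (matching⇒monoCopy KminusP-sym)
                             (KminusP-matchings m′ n R≡ m≤n 2≤n c)
  below-R : ∀ s → s ℕ.< R → ¬ Arrows (K s) (matching (suc m′)) (matching n)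
  below-R s s<R = ¬K-arrows-matchings (≤-trans (s≤s z≤n) 2≤n) (subst (s ℕ.<_) R≡ s<R)
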